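{- Let $\rho$ be a growth function, let $m\geq1$ and $0\leq k\leq m$ be integers, and let $\sigma\in\{ -1,1\}^m$ contain exactly $k$ entries equal to $1$. Define $\theta=(\theta_1,\dots,\theta_m)$ by $\theta_i=1$ for $1\leq i\leq k$ and $\theta_i=-1$ for $k+1\leq i\leq m$. If $f^\rho_\sigma=(a_\sigma,b_\sigma)$ and $f^\rho_\theta=(a_\theta,b_\theta)$, then $a_\sigma\leq a_\theta$ and $b_\sigma=b_\theta$.
   Context: A growth function is an increasing $\rho:\mathbb{R}\to\mathbb{R}^{\geq0}$. $f^\rho_\sigma\in\mathbb{R}\times\mathbb{R}$ for binary strings $\sigma$ is defined recursively: for the empty string $f^\rho_{<>}=(0,0)$, and if $f^\rho_\sigma=(a,b)$ then appending $1$ gives $(a+1,b+1)$ and appending $-1$ gives $(a+\rho(a+b),b-1)$. -}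

module Defs where

open import Level using (Level; _⊔_) renaming (suc to lsuc)
open import Data.Nat using (ℕ; _∸_)
open import Data.List using (List; []; _∷_; _++_; replicate; foldl; filter; length)
open import Data.Product using (_×_; _,_; Σ; ∃)
open import Data.Sum using (_⊎_)
open import Relation.Nullary using (¬_; Dec; yes; no)
open import Relation.Binary.PropositionalEquality using (_≡_)

-- An axiomatisation of the real numbers: a complete ordered field
-- (any model is isomorphic to ℝ).  Equality is propositional equality.
record RealNumbers : Set₁ where
  infixl 6 _+_
  infixl 7 _*_
  infix 4 _≤_
  field
    ℝ      : Set
    0ℝ 1ℝ  : ℝ
    _+_ _*_ : ℝ → ℝ → ℝ
    -_     : ℝ → ℝ
    _⁻¹    : (x : ℝ) → ¬ (x ≡ 0ℝ) → ℝ
    _≤_    : ℝ → ℝ → Set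
    +-assoc  : ∀ x y z → (x + y) + z ≡ x + (y + z)
    +-comm   : ∀ x y → x + y ≡ y + x
    +-identityˡ : ∀ x → 0ℝ + x ≡ x
    -‿inverseˡ  : ∀ x → (- x) + x ≡ 0ℝ
    *-assoc  : ∀ x y z → (x * y) * z ≡ x * (y * z)
    *-comm   : ∀ x y → x * y ≡ y * x
    *-identityˡ : ∀ x → 1ℝ * x ≡ x
    ⁻¹-inverseˡ : ∀ x (x≢0 : ¬ (x ≡ 0ℝ)) → (x ⁻¹) x≢0 * x ≡ 1ℝ
    distribˡ : ∀ x y z → x * (y + z) ≡ x * y + x * z
    0≢1      : ¬ (0ℝ ≡ 1ℝ)
    ≤-refl    : ∀ x → x ≤ x
    ≤-trans   : ∀ {x y z} → x ≤ y → y ≤ z → x ≤ z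
    ≤-antisym : ∀ {x y} → x ≤ y → y ≤ x → x ≡ y
    ≤-total   : ∀ x y → x ≤ y ⊎ y ≤ x
    +-monoˡ-≤ : ∀ {x y} z → x ≤ y → x + z ≤ y + z
    *-nonneg  : ∀ {x y} → 0ℝ ≤ x → 0ℝ ≤ y → 0ℝ ≤ x * y
    complete  : (S : ℝ → Set) → (∃ λ x → S x) → (∃ λ b → ∀ x → S x → x ≤ b) →
                ∃ λ s → (∀ x → S x → x ≤ s) × (∀ b → (∀ x → S x → x ≤ b) → s ≤ b)

data Sign : Set where
  plus  : Sign
  minus : Sign

isPlus : (s : Sign) → Dec (s ≡ plus)
isPlus plus  = yes _≡_.refl
isPlus minus = no λ ()

countPlus : List Sign → ℕ
countPlus σ = length (filter isPlus σ)

theta : ℕ → ℕ → List Sign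
theta k m = replicate k plus ++ replicate (m ∸ k) minus

module _ (R : RealNumbers) where
  open RealNumbers R

  _-ℝ_ : ℝ → ℝ → ℝ
  x -ℝ y = x + (- y)

  IsGrowthFunction : (ℝ → ℝ) → Set
  IsGrowthFunction ρ = (∀ {x y} → x ≤ y → ρ x ≤ ρ y) × (∀ x → 0ℝ ≤ ρ x)

  step : (ℝ → ℝ) → ℝ × ℝ → Sign → ℝ × ℝ
  step ρ (a , b) plus  = (a + 1ℝ , b + 1ℝ)
  step ρ (a , b) minus = (a + ρ (a + b) , b -ℝ 1ℝ)

  -- f^ρ_σ, with f^ρ_<> = (0,0) and f^ρ_{σ s} = step (f^ρ_σ) s
  f : (ℝ → ℝ) → List Sign → ℝ × ℝ
  f ρ σ = foldl (step ρ) (0ℝ , 0ℝ) σ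

-- Swapping an adjacent pair (-1, 1) into (1, -1) leaves b unchanged and cannot
-- decrease a: both orders add 1 to a and one value of ρ, but after the swap ρ is
-- evaluated at a + b + 2 instead of a + b.  Every later step is monotone in a
-- for fixed b, so moving all the 1s of σ to the front, one swap at a time,
-- turns σ into θ without decreasing a or changing b.
module Submission where

open import Algebra.Bundles using (CommutativeRing)
open import Algebra.Structures using (IsCommutativeRing)
open import Algebra.Consequences.Propositional
  using (comm∧idˡ⇒id; comm∧invˡ⇒invʳ; comm∧distrˡ⇒distrʳ)
import Algebra.Properties.Ring as RingProperties
import Algebra.Solver.CommutativeMonoid as CommutativeMonoidSolver
open import Data.Nat using (ℕ; zero; suc; _∸_; z≤n; s≤s) renaming (_≤_ to _≤ℕ_)
open import Data.Nat.Properties using (+-∸-assoc; m≤n⇒m≤1+n)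
open import Data.List using (List; []; _∷_; _++_; replicate; foldl; length)
open import Data.Product using (_×_; _,_; proj₁; proj₂)
open import Data.Sum using (inj₁; inj₂)
open import Relation.Binary.PropositionalEquality
  using (_≡_; refl; sym; trans; cong; cong₂; subst; subst₂; isEquivalence)

open import Defs

countMinus : List Sign → ℕ
countMinus []          = 0
countMinus (plus ∷ σ)  = countMinus σ
countMinus (minus ∷ σ) = suc (countMinus σ)

countPlus≤length : ∀ σ → countPlus σ ≤ℕ length σ
countPlus≤length []          = z≤n
countPlus≤length (plus ∷ σ)  = s≤s (countPlus≤length σ)
countPlus≤length (minus ∷ σ) = m≤n⇒m≤1+n (countPlus≤length σ)

countMinus≡length∸countPlus : ∀ σ → countMinus σ ≡ length σ ∸ countPlus σ
countMinus≡length∸countPlus []          = refl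
countMinus≡length∸countPlus (plus ∷ σ)  = countMinus≡length∸countPlus σ
countMinus≡length∸countPlus (minus ∷ σ) =
  trans (cong suc (countMinus≡length∸countPlus σ))
        (sym (+-∸-assoc 1 (countPlus≤length σ)))

plusesThenMinuses : ℕ → ℕ → List Sign
plusesThenMinuses p q = replicate p plus ++ replicate q minus

module OrderedFieldProperties (R : RealNumbers) where
  open RealNumbers R

  isCommutativeRing : IsCommutativeRing _≡_ _+_ _*_ -_ 0ℝ 1ℝ
  isCommutativeRing = record
    { isRing = record
      { +-isAbelianGroup = record
        { isGroup = record
          { isMonoid = record
            { isSemigroup = record
              { isMagma = record { isEquivalence = isEquivalence ; ∙-cong = cong₂ _+_ }
              ; assoc   = +-assoc
              }
            ; identity = comm∧idˡ⇒id +-comm +-identityˡ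
            }
          ; inverse = -‿inverseˡ , comm∧invˡ⇒invʳ +-comm -‿inverseˡ
          ; ⁻¹-cong = cong -_
          }
        ; comm = +-comm
        }
      ; *-cong     = cong₂ _*_
      ; *-assoc    = *-assoc
      ; *-identity = comm∧idˡ⇒id *-comm *-identityˡ
      ; distrib    = distribˡ , comm∧distrˡ⇒distrʳ *-comm distribˡ
      }
    ; *-comm = *-comm
    }

  commutativeRing : CommutativeRing _ _
  commutativeRing = record { isCommutativeRing = isCommutativeRing }

  open CommutativeRing commutativeRing public
    using (+-identityʳ; -‿inverseʳ; +-commutativeMonoid)
  open RingProperties (CommutativeRing.ring commutativeRing) using (-1*x≈-x; -‿involutive)

  +-monoʳ-≤ : ∀ {x y} z → x ≤ y → z + x ≤ z + y
  +-monoʳ-≤ {x} {y} z x≤y = subst₂ _≤_ (+-comm x z) (+-comm y z) (+-monoˡ-≤ z x≤y)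

  +-mono-≤ : ∀ {x x′ y y′} → x ≤ x′ → y ≤ y′ → x + y ≤ x′ + y′
  +-mono-≤ {x′ = x′} {y} x≤x′ y≤y′ = ≤-trans (+-monoˡ-≤ y x≤x′) (+-monoʳ-≤ x′ y≤y′)

  x≤x+y : ∀ x {y} → 0ℝ ≤ y → x ≤ x + y
  x≤x+y x 0≤y = subst (_≤ x + _) (+-identityʳ x) (+-monoʳ-≤ x 0≤y)

  0≤1 : 0ℝ ≤ 1ℝ
  0≤1 with ≤-total 0ℝ 1ℝ
  ... | inj₁ 0≤1 = 0≤1
  ... | inj₂ 1≤0 = subst (0ℝ ≤_) -1*-1≡1 (*-nonneg 0≤-1 0≤-1)
    where
    0≤-1 : 0ℝ ≤ - 1ℝ
    0≤-1 = subst₂ _≤_ (-‿inverseʳ 1ℝ) (+-identityˡ (- 1ℝ)) (+-monoˡ-≤ (- 1ℝ) 1≤0)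

    -1*-1≡1 : (- 1ℝ) * (- 1ℝ) ≡ 1ℝ
    -1*-1≡1 = trans (-1*x≈-x (- 1ℝ)) (-‿involutive 1ℝ)

module Dominance (R : RealNumbers) (ρ : RealNumbers.ℝ R → RealNumbers.ℝ R)
                 (ρ-mono : ∀ {x y} → RealNumbers._≤_ R x y → RealNumbers._≤_ R (ρ x) (ρ y))
                 where
  open RealNumbers R
  open OrderedFieldProperties R
  open CommutativeMonoidSolver +-commutativeMonoid using (solve; _⊜_; _⊕_)

  run : ℝ × ℝ → List Sign → ℝ × ℝ
  run = foldl (step R ρ)

  infix 4 _≼_
  _≼_ : ℝ × ℝ → ℝ × ℝ → Set
  s ≼ t = proj₁ s ≤ proj₁ t × proj₂ s ≡ proj₂ t

  ≼-refl : ∀ s → s ≼ s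
  ≼-refl s = ≤-refl (proj₁ s) , refl

  ≼-trans : ∀ {s t u} → s ≼ t → t ≼ u → s ≼ u
  ≼-trans (a≤a′ , b≡b′) (a′≤a″ , b′≡b″) = ≤-trans a≤a′ a′≤a″ , trans b≡b′ b′≡b″

  step-mono : ∀ {s t} c → s ≼ t → step R ρ s c ≼ step R ρ t c
  step-mono {a , b} plus  (a≤a′ , refl) = +-monoˡ-≤ 1ℝ a≤a′ , refl
  step-mono {a , b} minus (a≤a′ , refl) = +-mono-≤ a≤a′ (ρ-mono (+-monoˡ-≤ b a≤a′)) , refl

  run-mono : ∀ {s t} σ → s ≼ t → run s σ ≼ run t σ
  run-mono []      s≼t = s≼t
  run-mono (c ∷ σ) s≼t = run-mono σ (step-mono c s≼t)

  step-swap : ∀ s → step R ρ (step R ρ s minus) plus ≼ step R ρ (step R ρ s plus) minus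
  step-swap (a , b) = a-grows , swap₂ b (- 1ℝ) 1ℝ
    where
    swap₂ : ∀ x y z → (x + y) + z ≡ (x + z) + y
    swap₂ = solve 3 (λ x y z → (x ⊕ y) ⊕ z ⊜ (x ⊕ z) ⊕ y) refl

    a+b≤a+1+b+1 : a + b ≤ (a + 1ℝ) + (b + 1ℝ)
    a+b≤a+1+b+1 = subst (a + b ≤_) (regroup a b 1ℝ) (x≤x+y (a + b) 0≤1+1)
      where
      regroup : ∀ x y z → (x + y) + (z + z) ≡ (x + z) + (y + z)
      regroup = solve 3 (λ x y z → (x ⊕ y) ⊕ (z ⊕ z) ⊜ (x ⊕ z) ⊕ (y ⊕ z)) refl

      0≤1+1 : 0ℝ ≤ 1ℝ + 1ℝ
      0≤1+1 = subst (_≤ 1ℝ + 1ℝ) (+-identityˡ 0ℝ) (+-mono-≤ 0≤1 0≤1)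

    a-grows : (a + ρ (a + b)) + 1ℝ ≤ (a + 1ℝ) + ρ ((a + 1ℝ) + (b + 1ℝ))
    a-grows = subst (_≤ (a + 1ℝ) + ρ ((a + 1ℝ) + (b + 1ℝ))) (swap₂ a 1ℝ (ρ (a + b)))
                    (+-monoʳ-≤ (a + 1ℝ) (ρ-mono a+b≤a+1+b+1))

  run-minus-past-pluses : ∀ p q s →
    run (step R ρ s minus) (plusesThenMinuses p q) ≼ run s (plusesThenMinuses p (suc q))
  run-minus-past-pluses zero    q s = ≼-refl _
  run-minus-past-pluses (suc p) q s =
    ≼-trans (run-mono (plusesThenMinuses p q) (step-swap s))
            (run-minus-past-pluses p q (step R ρ s plus))

  run-≼-sorted : ∀ σ s → run s σ ≼ run s (plusesThenMinuses (countPlus σ) (countMinus σ))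
  run-≼-sorted []          s = ≼-refl s
  run-≼-sorted (plus ∷ σ)  s = run-≼-sorted σ (step R ρ s plus)
  run-≼-sorted (minus ∷ σ) s =
    ≼-trans (run-≼-sorted σ (step R ρ s minus))
            (run-minus-past-pluses (countPlus σ) (countMinus σ) s)

lemma4p16 : (R : RealNumbers) (ρ : RealNumbers.ℝ R → RealNumbers.ℝ R) →
    IsGrowthFunction R ρ →
    (m k : ℕ) → 1 ≤ℕ m → k ≤ℕ m →
    (σ : List Sign) → length σ ≡ m → countPlus σ ≡ k →
    RealNumbers._≤_ R (proj₁ (f R ρ σ)) (proj₁ (f R ρ (theta k m)))
    × proj₂ (f R ρ σ) ≡ proj₂ (f R ρ (theta k m))
lemma4p16 R ρ (ρ-mono , _) m k _ _ σ refl refl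
  rewrite sym (countMinus≡length∸countPlus σ) =
    Dominance.run-≼-sorted R ρ ρ-mono σ (RealNumbers.0ℝ R , RealNumbers.0ℝ R)
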